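{- For every $n\ge 1$, $|\mathcal{RS}_n(213)|=M_n$, where $M_n$ is the $n$th Motzkin number.
   Context: For $\sigma\in\mathfrak{S}_n$, a double descent is an index $i$ with $\sigma_i>\sigma_{i+1}>\sigma_{i+2}$. The permutation $\sigma$ is simsun if for every $k$, the subword of $\sigma$ consisting of the letters in $\{1,\dots,k\}$ (in the order they appear in $\sigma$) has no double descent. For $\omega\in\mathfrak{S}_t$, $\sigma$ contains an $\omega$-pattern if there are indices $i_1<\cdots<i_t$ with $\sigma_{i_j}<\sigma_{i_k}$ iff $\omega_j<\omega_k$; otherwise $\sigma$ is $\omega$-avoiding. $\mathcal{RS}_n(\omega)$ is the set of $\omega$-avoiding simsun permutations in $\mathfrak{S}_n$. The Motzkin number $M_n$ is the number of lattice paths from $(0,0)$ to $(n,0)$ with steps $(1,1)$, $(1,-1)$, $(1,0)$ never going below the $x$-axis. -}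

module Defs where

open import Data.Nat using (ℕ; zero; suc; _+_; _<_; _>_; _<?_)
open import Data.Fin using (Fin; toℕ)
open import Data.Vec using (Vec; lookup; toList)
open import Data.List using (List; []; _∷_; filter; map; length)
open import Data.List.Membership.Propositional using (_∈_)
open import Data.List.Relation.Unary.Unique.Propositional using (Unique)
open import Data.Product using (Σ; ∃; _×_)
open import Function.Bundles using (_⇔_)
open import Relation.Nullary using (¬_)
open import Relation.Binary.PropositionalEquality using (_≡_)

-- A word of length n over the alphabet Fin n; letter value j : Fin n stands
-- for the paper's letter j+1 (order-preserving shift, irrelevant for all
-- notions below).
Word : ℕ → Set
Word n = Vec (Fin n) n

-- σ is a permutation of the alphabet: injective (hence bijective on Fin n).
IsPerm : ∀ {n} → Word n → Set
IsPerm {n} σ = ∀ (i j : Fin n) → lookup σ i ≡ lookup σ j → i ≡ j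

data HasDoubleDescent : List ℕ → Set where
  here  : ∀ {a b c l} → a > b → b > c → HasDoubleDescent (a ∷ b ∷ c ∷ l)
  there : ∀ {x l} → HasDoubleDescent l → HasDoubleDescent (x ∷ l)

-- Subword of σ consisting of the k smallest letters (values < k here, i.e.
-- the paper's letters {1,…,k}), in the order they appear in σ.
restrict : ∀ {n} → ℕ → Word n → List ℕ
restrict k σ = filter (λ x → x <? k) (map toℕ (toList σ))

Simsun : ∀ {n} → Word n → Set
Simsun σ = ∀ (k : ℕ) → ¬ HasDoubleDescent (restrict k σ)

Contains213 : ∀ {n} → Word n → Set
Contains213 {n} σ =
  Σ (Fin n) λ i → Σ (Fin n) λ j → Σ (Fin n) λ l →
    (toℕ i < toℕ j) × (toℕ j < toℕ l) ×
    (toℕ (lookup σ j) < toℕ (lookup σ i)) × (toℕ (lookup σ i) < toℕ (lookup σ l))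

RS213 : ∀ n → Word n → Set
RS213 n σ = IsPerm σ × Simsun σ × ¬ Contains213 σ

HasCard : ∀ {A : Set} → (A → Set) → ℕ → Set
HasCard {A} P m =
  Σ (List A) λ L → Unique L × (∀ x → (x ∈ L) ⇔ P x) × (length L ≡ m)

-- motzkinPaths len h = number of lattice paths with len steps (1,1),(1,-1),(1,0)
-- starting at height h, ending at height 0, never going below the x-axis.
motzkinPaths : ℕ → ℕ → ℕ
motzkinPaths zero zero = 1
motzkinPaths zero (suc h) = 0
motzkinPaths (suc len) zero = motzkinPaths len 1 + motzkinPaths len 0
motzkinPaths (suc len) (suc h) =
  motzkinPaths len (suc (suc h)) + motzkinPaths len (suc h) + motzkinPaths len h

motzkin : ℕ → ℕ
motzkin n = motzkinPaths n 0

-- Since n is the largest letter, a permutation in RS_{n+1}(213) is obtained from one in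
-- RS_n(213) by inserting n after an increasing prefix (a descent x > z before n would form
-- the pattern x z n) and in front of a suffix that does not start with a descent (n would
-- top a double descent); smaller letters are not affected by the insertion. Labelling each
-- permutation by its number of admissible positions minus one turns RS(213) into the
-- generating tree with rule (k) → (0) (1) … (k-1) (k+1). The number of nodes at depth len
-- below a node labelled k is Σⱼ (k choose j) M(len, j), where M(len, j) counts Motzkin
-- paths of length len from height j down to 0: the Motzkin recurrence for M is exactly the
-- generating rule after a binomial transform. At the root this is M(n, 0) = Mₙ.
{-# OPTIONS --safe #-}
module Submission where

open import Defs
import Data.Nat as ℕ
open import Data.Nat using (ℕ; zero; suc; _+_; _<_; _≤_; _≮_; _<?_; _≤?_; z<s; s<s)
open import Data.Nat.Properties
  using ( 1+n≰n; suc-injective; +-suc; +-comm; +-assoc; +-identityʳ; <-asym; <-irrefl; <-trans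
        ; ≤∧≢⇒<; ≮⇒≥; ≤⇒≯; ≰⇒>; >⇒≢; <⇒≢; ≤-refl; ≤-pred; n<1+n; m<n⇒m<1+n; m<1+n⇒m<n∨m≡n)
open import Data.Nat.Solver using (module +-*-Solver)
open import Data.Nat.ListAction using (sum)
open import Data.Nat.ListAction.Properties using (sum-++)
open import Data.Fin using (Fin; toℕ; fromℕ<; punchOut)
open import Data.Fin.Properties
  using (toℕ<n; toℕ-injective; toℕ-fromℕ<; fromℕ<-toℕ; punchOut-injective; injective⇒≤; any?)
  renaming (_≟_ to _≟ᶠ_)
open import Data.Vec as Vec using (Vec; lookup; toList)
open import Data.List using (List; []; _∷_; _++_; map; filter; length; concatMap; tabulate)
open import Data.List.Properties
  using ( ∷-injectiveˡ; ∷-injectiveʳ; map-++; map-∘; map-cong-local; map-id-local; length-map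
        ; length-tabulate; filter-all; filter-++; filter-reject)
open import Data.List.Relation.Unary.All as All using (All; []; _∷_)
import Data.List.Relation.Unary.All.Properties as All
open import Data.List.Relation.Unary.AllPairs using (AllPairs; []; _∷_)
open import Data.List.Relation.Unary.Any using (here; there)
open import Data.List.Membership.Propositional using (_∈_)
open import Data.List.Membership.Propositional.Properties
  using (∈-++⁺ˡ; ∈-++⁺ʳ; ∈-map⁺; ∈-map⁻; ∈-∃++; >>=-∈↔; ∈-tabulate⁺; ∈-tabulate⁻)
open import Data.List.Relation.Unary.Unique.Propositional using (Unique)
import Data.List.Relation.Unary.Unique.Propositional.Properties as Unique
open import Data.List.Relation.Binary.Permutation.Propositional using (↭-sym; ↭⇒↭ₛ)
open import Data.List.Relation.Binary.Permutation.Propositional.Properties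
  using (shift; All-resp-↭; ∈-resp-↭; ↭-length)
import Data.List.Relation.Binary.Permutation.Setoid.Properties as Permutationₛ
open import Data.Product using (Σ; ∃; _×_; _,_; proj₂)
open import Data.Sum as Sum using (_⊎_; inj₁; inj₂)
open import Data.Empty using (⊥; ⊥-elim)
open import Function.Base using (_∘_)
open import Function.Bundles using (_⇔_; mk⇔; Inverse; Equivalence)
open import Relation.Nullary using (¬_; Dec; yes; no)
open import Relation.Binary.PropositionalEquality
  using (_≡_; _≢_; _≗_; refl; sym; trans; cong; cong₂; subst; ≢-sym; setoid; module ≡-Reasoning)

open +-*-Solver using (solve; _:+_; _:=_; con)

-- The generating tree and Motzkin numbers

sumBelow : (ℕ → ℕ) → ℕ → ℕ
sumBelow g zero = 0
sumBelow g (suc k) = g 0 + sumBelow (g ∘ suc) k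

sumBelow-cong : ∀ {g h} → g ≗ h → sumBelow g ≗ sumBelow h
sumBelow-cong g≗h zero = refl
sumBelow-cong g≗h (suc k) = cong₂ _+_ (g≗h 0) (sumBelow-cong (g≗h ∘ suc) k)

sumBelow-suc : ∀ g k → sumBelow g (suc k) ≡ sumBelow g k + g k
sumBelow-suc g zero = +-comm (g 0) 0
sumBelow-suc g (suc k) =
  trans (cong (g 0 +_) (sumBelow-suc (g ∘ suc) k)) (sym (+-assoc (g 0) _ _))

-- binomialTransform u k = Σⱼ (k choose j) · u j, by Pascal's rule.
binomialTransform : (ℕ → ℕ) → ℕ → ℕ
binomialTransform u zero = u 0
binomialTransform u (suc k) = binomialTransform u k + binomialTransform (u ∘ suc) k

binomialTransform-cong : ∀ {u v} → u ≗ v → binomialTransform u ≗ binomialTransform v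
binomialTransform-cong u≗v zero = u≗v 0
binomialTransform-cong u≗v (suc k) =
  cong₂ _+_ (binomialTransform-cong u≗v k) (binomialTransform-cong (u≗v ∘ suc) k)

binomialTransform-zero : ∀ {u} → (∀ j → u j ≡ 0) → ∀ k → binomialTransform u k ≡ 0
binomialTransform-zero u≡0 zero = u≡0 0
binomialTransform-zero u≡0 (suc k) =
  cong₂ _+_ (binomialTransform-zero u≡0 k) (binomialTransform-zero (u≡0 ∘ suc) k)

binomialTransform-hockeyStick : ∀ u k →
  binomialTransform u k ≡ u 0 + sumBelow (binomialTransform (u ∘ suc)) k
binomialTransform-hockeyStick u zero = sym (+-identityʳ (u 0))
binomialTransform-hockeyStick u (suc k) = begin
  B u k + B u′ k                            ≡⟨ cong (_+ B u′ k) (binomialTransform-hockeyStick u k) ⟩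
  u 0 + sumBelow (B u′) k + B u′ k          ≡⟨ +-assoc (u 0) _ _ ⟩
  u 0 + (sumBelow (B u′) k + B u′ k)        ≡⟨ cong (u 0 +_) (sumBelow-suc (B u′) k) ⟨
  u 0 + sumBelow (B u′) (suc k)             ∎
  where
  open ≡-Reasoning
  B : (ℕ → ℕ) → ℕ → ℕ
  B = binomialTransform
  u′ : ℕ → ℕ
  u′ = u ∘ suc

-- u (j-1) + u j + u (j+1), with a standing for u (-1).
motzkinStep : ℕ → (ℕ → ℕ) → ℕ → ℕ
motzkinStep a u zero = a + u 0 + u 1
motzkinStep a u (suc j) = u j + u (suc j) + u (suc (suc j))

motzkinStep-suc : ∀ a u j → motzkinStep a u (suc j) ≡ motzkinStep (u 0) (u ∘ suc) j
motzkinStep-suc a u zero = refl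
motzkinStep-suc a u (suc j) = refl

motzkinPaths-suc : ∀ len → motzkinPaths (suc len) ≗ motzkinStep 0 (motzkinPaths len)
motzkinPaths-suc len zero = +-comm (motzkinPaths len 1) _
motzkinPaths-suc len (suc h) =
  solve 3 (λ x y z → x :+ y :+ z := z :+ y :+ x) refl
    (motzkinPaths len (suc (suc h))) (motzkinPaths len (suc h)) (motzkinPaths len h)

binomialTransform-motzkinStep : ∀ k a u →
  binomialTransform (motzkinStep a u) k ≡
  sumBelow (binomialTransform u) k + binomialTransform u (suc k) + a
binomialTransform-motzkinStep zero a u =
  solve 3 (λ a x y → a :+ x :+ y := con 0 :+ (x :+ y) :+ a) refl a (u 0) (u 1)
binomialTransform-motzkinStep (suc k) a u = begin
  B (motzkinStep a u) k + B (motzkinStep a u ∘ suc) k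
    ≡⟨ cong₂ _+_ (binomialTransform-motzkinStep k a u)
                 (trans (binomialTransform-cong (motzkinStep-suc a u) k)
                        (binomialTransform-motzkinStep k (u 0) u′)) ⟩
  (sumBelow (B u) k + B u (suc k) + a) + (sumBelow (B u′) k + B u′ (suc k) + u 0)
    ≡⟨ solve 6 (λ s t a s′ t′ u₀ → (s :+ t :+ a) :+ (s′ :+ t′ :+ u₀)
                                 := s :+ (u₀ :+ s′) :+ (t :+ t′) :+ a)
         refl (sumBelow (B u) k) (B u (suc k)) a (sumBelow (B u′) k) (B u′ (suc k)) (u 0) ⟩
  sumBelow (B u) k + (u 0 + sumBelow (B u′) k) + B u (suc (suc k)) + a
    ≡⟨ cong (λ z → sumBelow (B u) k + z + B u (suc (suc k)) + a)
            (binomialTransform-hockeyStick u k) ⟨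
  sumBelow (B u) k + B u k + B u (suc (suc k)) + a
    ≡⟨ cong (λ z → z + B u (suc (suc k)) + a) (sumBelow-suc (B u) k) ⟨
  sumBelow (B u) (suc k) + B u (suc (suc k)) + a ∎
  where
  open ≡-Reasoning
  B : (ℕ → ℕ) → ℕ → ℕ
  B = binomialTransform
  u′ : ℕ → ℕ
  u′ = u ∘ suc

-- The number of nodes at depth len below a node labelled k in the generating tree
-- with rule (k) → (0) (1) … (k-1) (k+1).
treeCount : ℕ → ℕ → ℕ
treeCount zero k = 1
treeCount (suc len) k = sumBelow (treeCount len) k + treeCount len (suc k)

treeCount≡binomialTransform : ∀ len → treeCount len ≗ binomialTransform (motzkinPaths len)
treeCount≡binomialTransform zero k = sym (binomialTransform-paths₀ k)
  where
  binomialTransform-paths₀ : ∀ k → binomialTransform (motzkinPaths 0) k ≡ 1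
  binomialTransform-paths₀ zero = refl
  binomialTransform-paths₀ (suc k) =
    cong₂ _+_ (binomialTransform-paths₀ k) (binomialTransform-zero (λ _ → refl) k)
treeCount≡binomialTransform (suc len) k = begin
  sumBelow (treeCount len) k + treeCount len (suc k)
    ≡⟨ cong₂ _+_ (sumBelow-cong (treeCount≡binomialTransform len) k)
                 (treeCount≡binomialTransform len (suc k)) ⟩
  sumBelow (B u) k + B u (suc k)     ≡⟨ +-identityʳ _ ⟨
  sumBelow (B u) k + B u (suc k) + 0 ≡⟨ binomialTransform-motzkinStep k 0 u ⟨
  B (motzkinStep 0 u) k              ≡⟨ binomialTransform-cong (motzkinPaths-suc len) k ⟨
  B (motzkinPaths (suc len)) k       ∎
  where
  open ≡-Reasoning
  B : (ℕ → ℕ) → ℕ → ℕ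
  B = binomialTransform
  u : ℕ → ℕ
  u = motzkinPaths len

≮∧≢⇒> : ∀ {x y} → x ≮ y → x ≢ y → y < x
≮∧≢⇒> x≮y x≢y = ≤∧≢⇒< (≮⇒≥ x≮y) (≢-sym x≢y)

module _ {A : Set} where

  ∈-insert : ∀ {v n : A} {b} a → v ∈ a ++ b → v ∈ a ++ n ∷ b
  ∈-insert a v∈ = ∈-resp-↭ (↭-sym (shift _ a _)) (there v∈)

  All-insert : ∀ {P : A → Set} {n b} a → P n → All P (a ++ b) → All P (a ++ n ∷ b)
  All-insert a pn pab = All-resp-↭ (↭-sym (shift _ a _)) (pn ∷ pab)

  All-delete : ∀ {P : A → Set} {n b} a → All P (a ++ n ∷ b) → P n × All P (a ++ b)
  All-delete a p with All-resp-↭ (shift _ a _) p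
  ... | pn ∷ pab = pn , pab

  Unique-insert : ∀ {n : A} {b} a → All (n ≢_) (a ++ b) → Unique (a ++ b) → Unique (a ++ n ∷ b)
  Unique-insert a n∉ unique =
    Permutationₛ.Unique-resp-↭ (setoid A) (↭⇒↭ₛ (↭-sym (shift _ a _))) (n∉ ∷ unique)

  Unique-delete : ∀ {n : A} {b} a → Unique (a ++ n ∷ b) → All (n ≢_) (a ++ b) × Unique (a ++ b)
  Unique-delete a unique with Permutationₛ.Unique-resp-↭ (setoid A) (↭⇒↭ₛ (shift _ a _)) unique
  ... | n∉ ∷ unique′ = n∉ , unique′

  Unique-++⁻ʳ : ∀ (a : List A) {b} → Unique (a ++ b) → Unique b
  Unique-++⁻ʳ [] unique = unique
  Unique-++⁻ʳ (_ ∷ a) (_ ∷ unique) = Unique-++⁻ʳ a unique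

  Unique-tabulate⁻ : ∀ {k} {f : Fin k → A} → Unique (tabulate f) → ∀ {i j} → f i ≡ f j → i ≡ j
  Unique-tabulate⁻ {suc k} _ {Fin.zero} {Fin.zero} _ = refl
  Unique-tabulate⁻ {suc k} {f} (f₀∉ ∷ _) {Fin.zero} {Fin.suc j} f₀≡fⱼ =
    ⊥-elim (All.lookup f₀∉ (∈-tabulate⁺ {f = f ∘ Fin.suc} j) f₀≡fⱼ)
  Unique-tabulate⁻ {suc k} {f} (f₀∉ ∷ _) {Fin.suc i} {Fin.zero} fᵢ≡f₀ =
    ⊥-elim (All.lookup f₀∉ (∈-tabulate⁺ {f = f ∘ Fin.suc} i) (sym fᵢ≡f₀))
  Unique-tabulate⁻ {suc k} (_ ∷ unique) {Fin.suc i} {Fin.suc j} fᵢ≡fⱼ =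
    cong Fin.suc (Unique-tabulate⁻ unique fᵢ≡fⱼ)

  Unique-concatMap : ∀ {B : Set} {f : A → List B} (g : B → A) {L} → Unique L →
                     (∀ {x} → x ∈ L → Unique (f x)) → (∀ {x y} → x ∈ L → y ∈ f x → g y ≡ x) →
                     Unique (concatMap f L)
  Unique-concatMap g [] _ _ = []
  Unique-concatMap {f = f} g {x ∷ L} (x∉ ∷ unique) uniqueᶠ g-inverts =
    Unique.++⁺ (uniqueᶠ (here refl))
               (Unique-concatMap g unique (uniqueᶠ ∘ there) (g-inverts ∘ there))
               disjoint
    where
    disjoint : ∀ {v} → ¬ (v ∈ f x × v ∈ concatMap f L)
    disjoint (v∈fx , v∈) with Inverse.from >>=-∈↔ v∈
    ... | y , y∈ , v∈fy =
      All.lookup x∉ y∈ (trans (sym (g-inverts (here refl) v∈fx)) (g-inverts (there y∈) v∈fy))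

  sum-concatMap : ∀ {B : Set} (g : B → ℕ) (f : A → List B) L →
                  sum (map g (concatMap f L)) ≡ sum (map (sum ∘ map g ∘ f) L)
  sum-concatMap g f [] = refl
  sum-concatMap g f (x ∷ L) = begin
    sum (map g (f x ++ concatMap f L))
      ≡⟨ cong sum (map-++ g (f x) _) ⟩
    sum (map g (f x) ++ map g (concatMap f L))
      ≡⟨ sum-++ (map g (f x)) _ ⟩
    sum (map g (f x)) + sum (map g (concatMap f L))
      ≡⟨ cong (sum (map g (f x)) +_) (sum-concatMap g f L) ⟩
    sum (map g (f x)) + sum (map (sum ∘ map g ∘ f) L) ∎
    where open ≡-Reasoning

  sum-map-cong : ∀ {g h : A → ℕ} L → (∀ {x} → x ∈ L → g x ≡ h x) → sum (map g L) ≡ sum (map h L)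
  sum-map-cong L g≡h = cong sum (map-cong-local (All.tabulate g≡h))

  sum-map-1 : ∀ (L : List A) → sum (map (λ _ → 1) L) ≡ length L
  sum-map-1 [] = refl
  sum-map-1 (_ ∷ L) = cong suc (sum-map-1 L)

-- The list form of RS_n(213)

Increasing : List ℕ → Set
Increasing = AllPairs _<_

StartsWithDescent : List ℕ → Set
StartsWithDescent (y ∷ z ∷ _) = y ≮ z
StartsWithDescent _ = ⊥

SimsunList : List ℕ → Set
SimsunList l = ∀ k → ¬ HasDoubleDescent (filter (_<? k) l)

data Precedes (u v : ℕ) : List ℕ → Set where
  here  : ∀ {l} → v ∈ l → Precedes u v (u ∷ l)
  there : ∀ {x l} → Precedes u v l → Precedes u v (x ∷ l)

data Has213 : List ℕ → Set where
  here  : ∀ {u x v l} → Precedes u v l → u < x → x < v → Has213 (x ∷ l)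
  there : ∀ {x l} → Has213 l → Has213 (x ∷ l)

-- `complete` follows from the other fields by pigeonhole; keeping it makes the
-- maximum easy to locate.
record IsRS213List (n : ℕ) (l : List ℕ) : Set where
  constructor isRS213List
  field
    bounded : All (_< n) l
    unique : Unique l
    length≡ : length l ≡ n
    complete : ∀ {k} → k < n → k ∈ l
    simsun : SimsunList l
    avoids213 : ¬ Has213 l

simsun⇒¬doubleDescent : ∀ {n l} → All (_< n) l → SimsunList l → ¬ HasDoubleDescent l
simsun⇒¬doubleDescent {n} l<n simsun dd =
  simsun n (subst HasDoubleDescent (sym (filter-all (_<? n) l<n)) dd)

filter-insert-≥ : ∀ {k n b} a → k ≤ n → filter (_<? k) (a ++ n ∷ b) ≡ filter (_<? k) (a ++ b)
filter-insert-≥ {k} {n} {b} a k≤n = begin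
  filter (_<? k) (a ++ n ∷ b)
    ≡⟨ filter-++ (_<? k) a (n ∷ b) ⟩
  filter (_<? k) a ++ filter (_<? k) (n ∷ b)
    ≡⟨ cong (filter (_<? k) a ++_) (filter-reject (_<? k) (≤⇒≯ k≤n)) ⟩
  filter (_<? k) a ++ filter (_<? k) b
    ≡⟨ filter-++ (_<? k) a b ⟨
  filter (_<? k) (a ++ b) ∎
  where open ≡-Reasoning

doubleDescent-++⁺ʳ : ∀ {l} a → HasDoubleDescent l → HasDoubleDescent (a ++ l)
doubleDescent-++⁺ʳ [] dd = dd
doubleDescent-++⁺ʳ (_ ∷ a) dd = there (doubleDescent-++⁺ʳ a dd)

doubleDescent-insertMax : ∀ {n b} a → All (_< n) (a ++ b) → HasDoubleDescent (a ++ n ∷ b) →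
                          HasDoubleDescent (a ++ b) ⊎ StartsWithDescent b
doubleDescent-insertMax [] _ (here _ y>z) = inj₂ (<-asym y>z)
doubleDescent-insertMax [] _ (there dd) = inj₁ dd
doubleDescent-insertMax (x ∷ []) (x<n ∷ _) (here x>n _) = ⊥-elim (<-asym x>n x<n)
doubleDescent-insertMax (x ∷ []) (_ ∷ <n) (there dd) =
  Sum.map₁ there (doubleDescent-insertMax [] <n dd)
doubleDescent-insertMax (x ∷ y ∷ []) (_ ∷ y<n ∷ _) (here _ y>n) = ⊥-elim (<-asym y>n y<n)
doubleDescent-insertMax (x ∷ y ∷ []) (_ ∷ <n) (there dd) =
  Sum.map₁ there (doubleDescent-insertMax (y ∷ []) <n dd)
doubleDescent-insertMax (x ∷ y ∷ z ∷ a) _ (here x>y y>z) = inj₁ (here x>y y>z)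
doubleDescent-insertMax (x ∷ y ∷ z ∷ a) (_ ∷ <n) (there dd) =
  Sum.map₁ there (doubleDescent-insertMax (y ∷ z ∷ a) <n dd)

simsun-insertMax : ∀ {n b} a → All (_< n) (a ++ b) → SimsunList (a ++ b) → ¬ StartsWithDescent b →
                   SimsunList (a ++ n ∷ b)
simsun-insertMax {n} {b} a <n simsun noDescent k with k ≤? n
... | yes k≤n = subst (¬_ ∘ HasDoubleDescent) (sym (filter-insert-≥ a k≤n)) (simsun k)
... | no k≰n = subst (¬_ ∘ HasDoubleDescent) (sym (filter-all (_<? k) <k)) ¬dd
  where
  <k : All (_< k) (a ++ n ∷ b)
  <k = All-insert a (≰⇒> k≰n) (All.map (λ p → <-trans p (≰⇒> k≰n)) <n)
  ¬dd : ¬ HasDoubleDescent (a ++ n ∷ b)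
  ¬dd dd with doubleDescent-insertMax a <n dd
  ... | inj₁ dd′ = simsun⇒¬doubleDescent <n simsun dd′
  ... | inj₂ descent = noDescent descent

simsun-deleteMax : ∀ {n b} a → All (_< n) (a ++ b) → SimsunList (a ++ n ∷ b) → SimsunList (a ++ b)
simsun-deleteMax {n} {b} a <n simsun k dd with k ≤? n
... | yes k≤n = simsun k (subst HasDoubleDescent (sym (filter-insert-≥ a k≤n)) dd)
... | no k≰n = simsun n (subst HasDoubleDescent (sym (filter-insert-≥ a ≤-refl))
                        (subst HasDoubleDescent (sym (filter-all (_<? n) <n))
                        (subst HasDoubleDescent (filter-all (_<? k) <k) dd)))
  where
  <k : All (_< k) (a ++ b)
  <k = All.map (λ p → <-trans p (≰⇒> k≰n)) <n

precedes-∈ʳ : ∀ {u v l} → Precedes u v l → v ∈ l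
precedes-∈ʳ (here v∈) = there v∈
precedes-∈ʳ (there p) = there (precedes-∈ʳ p)

precedes-++ : ∀ {u v} a {b} → u ∈ a → v ∈ b → Precedes u v (a ++ b)
precedes-++ (_ ∷ a) (here refl) v∈ = here (∈-++⁺ʳ a v∈)
precedes-++ (_ ∷ a) (there u∈) v∈ = there (precedes-++ a u∈ v∈)

precedes-insert : ∀ {n u v b} a → Precedes u v (a ++ b) → Precedes u v (a ++ n ∷ b)
precedes-insert [] p = there p
precedes-insert (_ ∷ a) (here v∈) = here (∈-insert a v∈)
precedes-insert (_ ∷ a) (there p) = there (precedes-insert a p)

precedes-delete : ∀ {n u v b} a → Precedes u v (a ++ n ∷ b) → u ≢ n →
                  u ∈ a ⊎ Precedes u v (a ++ b)
precedes-delete [] (here _) u≢n = ⊥-elim (u≢n refl)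
precedes-delete [] (there p) _ = inj₂ p
precedes-delete (_ ∷ a) (here _) _ = inj₁ (here refl)
precedes-delete (_ ∷ a) (there p) u≢n = Sum.map there there (precedes-delete a p u≢n)

has213-insert : ∀ {n b} a → Has213 (a ++ b) → Has213 (a ++ n ∷ b)
has213-insert [] p = there p
has213-insert (_ ∷ a) (here p u<x x<v) = here (precedes-insert a p) u<x x<v
has213-insert (_ ∷ a) (there p) = there (has213-insert a p)

-- The maximum n can only play the 3 of a 213, whose 2 1 is then a descent before n.
has213-deleteMax : ∀ {n b} a → Increasing a → All (_< n) (a ++ b) → Has213 (a ++ n ∷ b) →
                   Has213 (a ++ b)
has213-deleteMax [] _ <n (here p _ n<v) = ⊥-elim (<-asym n<v (All.lookup <n (precedes-∈ʳ p)))
has213-deleteMax [] _ _ (there p) = p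
has213-deleteMax (x ∷ a) (x<a ∷ _) (x<n ∷ _) (here p u<x x<v)
  with precedes-delete a p (<⇒≢ (<-trans u<x x<n))
... | inj₁ u∈a = ⊥-elim (<-asym u<x (All.lookup x<a u∈a))
... | inj₂ p′ = here p′ u<x x<v
has213-deleteMax (x ∷ a) (_ ∷ inc) (_ ∷ <n) (there p) = there (has213-deleteMax a inc <n p)

increasing-beforeMax : ∀ {n b} a → ¬ Has213 (a ++ n ∷ b) → Unique (a ++ b) → All (_< n) a →
                       Increasing a
increasing-beforeMax [] _ _ _ = []
increasing-beforeMax {n} {b} (x ∷ a) avoids (x∉ ∷ unique) (x<n ∷ <n) =
  All.tabulate x<z ∷ increasing-beforeMax a (avoids ∘ there) unique <n
  where
  x<z : ∀ {z} → z ∈ a → x < z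
  x<z {z} z∈ with x <? z
  ... | yes x<z = x<z
  ... | no x≮z = ⊥-elim (avoids (here (precedes-++ a z∈ (here refl))
                                       (≮∧≢⇒> x≮z (All.lookup x∉ (∈-++⁺ˡ z∈))) x<n))

noDescent-afterMax : ∀ {n b} a → All (_< n) b → Unique b → ¬ HasDoubleDescent (a ++ n ∷ b) →
                     ¬ StartsWithDescent b
noDescent-afterMax {b = []} _ _ _ _ ()
noDescent-afterMax {b = _ ∷ []} _ _ _ _ ()
noDescent-afterMax {b = _ ∷ _ ∷ _} a (y<n ∷ _) (y∉ ∷ _) ¬dd y≮z =
  ¬dd (doubleDescent-++⁺ʳ a (here y<n (≮∧≢⇒> y≮z (All.head y∉))))

insertMax-isRS213List : ∀ {n b} a → IsRS213List n (a ++ b) → Increasing a →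
                        ¬ StartsWithDescent b → IsRS213List (suc n) (a ++ n ∷ b)
insertMax-isRS213List {n} {b} a (isRS213List bounded unique length≡ complete simsun avoids)
                      inc noDescent =
  isRS213List (All-insert a (n<1+n n) (All.map m<n⇒m<1+n bounded))
              (Unique-insert a (All.map >⇒≢ bounded) unique)
              (trans (↭-length (shift n a b)) (cong suc length≡))
              complete′
              (simsun-insertMax a bounded simsun noDescent)
              (avoids ∘ has213-deleteMax a inc bounded)
  where
  complete′ : ∀ {k} → k < suc n → k ∈ a ++ n ∷ b
  complete′ k<1+n with m<1+n⇒m<n∨m≡n k<1+n
  ... | inj₁ k<n = ∈-insert a (complete k<n)
  ... | inj₂ refl = ∈-++⁺ʳ a (here refl)

deleteMax-isRS213List : ∀ {n b} a → IsRS213List (suc n) (a ++ n ∷ b) →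
                        IsRS213List n (a ++ b) × Increasing a × ¬ StartsWithDescent b
deleteMax-isRS213List {n} {b} a (isRS213List bounded unique length≡ complete simsun avoids)
  with Unique-delete a unique
... | n∉ , unique′ =
  isRS213List bounded′ unique′
              (cong ℕ.pred (trans (sym (↭-length (shift n a b))) length≡))
              complete′
              (simsun-deleteMax a bounded′ simsun)
              (avoids ∘ has213-insert a)
  , increasing-beforeMax a avoids unique′ (All.++⁻ˡ a bounded′)
  , noDescent-afterMax a (All.++⁻ʳ a bounded′) (Unique-++⁻ʳ a unique′)
                       (simsun⇒¬doubleDescent bounded simsun)
  where
  bounded′ : All (_< n) (a ++ b)
  bounded′ = All.zipWith (λ (k<1+n , n≢k) → ≤∧≢⇒< (≤-pred k<1+n) (≢-sym n≢k))
                         (proj₂ (All-delete a bounded) , n∉)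
  complete′ : ∀ {k} → k < n → k ∈ a ++ b
  complete′ k<n with ∈-resp-↭ (shift n a b) (complete (m<n⇒m<1+n k<n))
  ... | here refl = ⊥-elim (<-irrefl refl k<n)
  ... | there k∈ = k∈

-- The generating tree of RS(213)

-- Unlike `if does d then … else …`, this is stuck on `d` itself, so that
-- `with x <? y` in a proof makes it compute.
infix 0 ifDec_then_else_
ifDec_then_else_ : ∀ {P B : Set} → Dec P → B → B → B
ifDec yes _ then t else _ = t
ifDec no _ then _ else e = e

children : ℕ → List ℕ → List (List ℕ)
children m [] = (m ∷ []) ∷ []
children m (x ∷ []) = (m ∷ x ∷ []) ∷ (x ∷ m ∷ []) ∷ []
children m (x ∷ y ∷ l) =
  ifDec (x <? y)
  then (m ∷ x ∷ y ∷ l) ∷ map (x ∷_) (children m (y ∷ l))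
  else (x ∷ m ∷ y ∷ l) ∷ []

record InsertionOf (m : ℕ) (l c : List ℕ) : Set where
  constructor insertion
  field
    before after : List ℕ
    parent≡ : l ≡ before ++ after
    child≡ : c ≡ before ++ m ∷ after
    increasing : Increasing before
    noDescent : ¬ StartsWithDescent after

∈-children⁻ : ∀ {m c} l → Unique l → ¬ HasDoubleDescent l → c ∈ children m l → InsertionOf m l c
∈-children⁻ [] _ _ (here refl) = insertion [] [] refl refl [] (λ ())
∈-children⁻ (x ∷ []) _ _ (here refl) = insertion [] (x ∷ []) refl refl [] (λ ())
∈-children⁻ (x ∷ []) _ _ (there (here refl)) = insertion (x ∷ []) [] refl refl ([] ∷ []) (λ ())
∈-children⁻ (x ∷ y ∷ l) _ _ _ with x <? y
∈-children⁻ (x ∷ y ∷ l) _ _ (here refl) | yes x<y =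
  insertion [] (x ∷ y ∷ l) refl refl [] (λ x≮y → x≮y x<y)
∈-children⁻ (x ∷ y ∷ l) (_ ∷ unique) ¬dd (there c∈) | yes x<y with ∈-map⁻ (x ∷_) c∈
... | c , c∈′ , refl with ∈-children⁻ (y ∷ l) unique (¬dd ∘ there) c∈′
... | insertion a b parent≡ refl inc noDescent =
  insertion (x ∷ a) b (cong (x ∷_) parent≡) refl (x<before a parent≡ inc ∷ inc) noDescent
  where
  x<before : ∀ a {b} → y ∷ l ≡ a ++ b → Increasing a → All (x <_) a
  x<before [] _ _ = []
  x<before (_ ∷ a) y∷l≡ (y<a ∷ _) with ∷-injectiveˡ y∷l≡
  ... | refl = x<y ∷ All.map (<-trans x<y) y<a
∈-children⁻ (x ∷ y ∷ []) _ _ (here refl) | no _ =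
  insertion (x ∷ []) (y ∷ []) refl refl ([] ∷ []) (λ ())
∈-children⁻ (x ∷ y ∷ z ∷ l) (x∉ ∷ (y≢z ∷ _) ∷ _) ¬dd (here refl) | no x≮y =
  insertion (x ∷ []) (y ∷ z ∷ l) refl refl ([] ∷ [])
            (λ y≮z → ¬dd (here (≮∧≢⇒> x≮y (All.head x∉)) (≮∧≢⇒> y≮z y≢z)))

∈-children⁺ : ∀ {m} a b → Increasing a → ¬ StartsWithDescent b → a ++ m ∷ b ∈ children m (a ++ b)
∈-children⁺ [] [] _ _ = here refl
∈-children⁺ [] (x ∷ []) _ _ = here refl
∈-children⁺ [] (x ∷ y ∷ l) _ noDescent with x <? y
... | yes _ = here refl
... | no x≮y = ⊥-elim (noDescent x≮y)
∈-children⁺ (x ∷ []) [] _ _ = there (here refl)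
∈-children⁺ (x ∷ []) (y ∷ l) _ noDescent with x <? y
... | yes _ = there (∈-map⁺ (x ∷_) (∈-children⁺ [] (y ∷ l) [] noDescent))
... | no _ = here refl
∈-children⁺ (x ∷ z ∷ a) b (x<za ∷ inc) noDescent with x <? z
... | yes _ = there (∈-map⁺ (x ∷_) (∈-children⁺ (z ∷ a) b inc noDescent))
... | no x≮z = ⊥-elim (x≮z (All.head x<za))

children-unique : ∀ {m} l → All (_< m) l → Unique (children m l)
children-unique [] _ = [] ∷ []
children-unique (x ∷ []) (x<m ∷ _) = ((λ e → >⇒≢ x<m (∷-injectiveˡ e)) ∷ []) ∷ [] ∷ []
children-unique (x ∷ y ∷ l) (x<m ∷ <m) with x <? y
... | yes _ = All.map⁺ (All.universal (λ _ e → >⇒≢ x<m (∷-injectiveˡ e)) _)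
              ∷ Unique.map⁺ ∷-injectiveʳ (children-unique (y ∷ l) <m)
... | no _ = [] ∷ []

filter-children : ∀ {m l c} → IsRS213List m l → c ∈ children m l → filter (_<? m) c ≡ l
filter-children {m} {l} (isRS213List bounded unique _ _ simsun _) c∈
  with ∈-children⁻ l unique (simsun⇒¬doubleDescent bounded simsun) c∈
... | insertion a b refl refl _ _ = trans (filter-insert-≥ a ≤-refl) (filter-all (_<? m) bounded)

-- label l + 1 is the number of children of l.
label : List ℕ → ℕ
label [] = 0
label (x ∷ []) = 1
label (x ∷ y ∷ l) = ifDec (x <? y) then suc (label (y ∷ l)) else 0

StartsAbove : ℕ → List ℕ → Set
StartsAbove x [] = ⊥
StartsAbove x (z ∷ _) = x < z

label-∷ : ∀ {x c} → StartsAbove x c → label (x ∷ c) ≡ suc (label c)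
label-∷ {x} {y ∷ []} x<y with x <? y
... | yes _ = refl
... | no x≮y = ⊥-elim (x≮y x<y)
label-∷ {x} {y ∷ z ∷ l} x<y with x <? y
... | yes _ = refl
... | no x≮y = ⊥-elim (x≮y x<y)

label-descent : ∀ {x y l} → x ≮ y → label (x ∷ y ∷ l) ≡ 0
label-descent {x} {y} x≮y with x <? y
... | yes x<y = ⊥-elim (x≮y x<y)
... | no _ = refl

children-startAbove : ∀ {x m} y l → x < m → x < y → All (StartsAbove x) (children m (y ∷ l))
children-startAbove y [] x<m x<y = x<m ∷ x<y ∷ []
children-startAbove y (z ∷ l) x<m x<y with y <? z
... | yes _ = x<m ∷ All.map⁺ (All.universal (λ _ → x<y) _)
... | no _ = x<y ∷ []

sum-label-∷ : ∀ {x} g K → All (StartsAbove x) K →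
              sum (map (g ∘ label) (map (x ∷_) K)) ≡ sum (map (g ∘ suc ∘ label) K)
sum-label-∷ g [] [] = refl
sum-label-∷ g (c ∷ K) (above ∷ aboves) =
  cong₂ _+_ (cong g (label-∷ above)) (sum-label-∷ g K aboves)

-- The children of a list labelled k are labelled 0, 1, …, k-1 and k+1.
sum-label-children : ∀ {m} l → All (_< m) l → ∀ g →
                     sum (map (g ∘ label) (children m l)) ≡ sumBelow g (label l) + g (suc (label l))
sum-label-children [] _ g = +-identityʳ (g 1)
sum-label-children {m} (x ∷ []) (x<m ∷ []) g
  rewrite label-descent {m} {x} {[]} (<-asym x<m) | label-∷ {x} {m ∷ []} x<m =
  trans (cong (g 0 +_) (+-identityʳ (g 2))) (cong (_+ g 2) (sym (+-identityʳ (g 0))))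
sum-label-children {m} (x ∷ y ∷ l) (x<m ∷ <m) g with x <? y
... | yes x<y rewrite label-descent {m} {x} {y ∷ l} (<-asym x<m) = begin
  g 0 + sum (map (g ∘ label) (map (x ∷_) (children m (y ∷ l))))
    ≡⟨ cong (g 0 +_) (sum-label-∷ g _ (children-startAbove y l x<m x<y)) ⟩
  g 0 + sum (map (g ∘ suc ∘ label) (children m (y ∷ l)))
    ≡⟨ cong (g 0 +_) (sum-label-children (y ∷ l) <m (g ∘ suc)) ⟩
  g 0 + (sumBelow (g ∘ suc) (label (y ∷ l)) + g (suc (suc (label (y ∷ l)))))
    ≡⟨ +-assoc (g 0) _ _ ⟨
  g 0 + sumBelow (g ∘ suc) (label (y ∷ l)) + g (suc (suc (label (y ∷ l)))) ∎
  where open ≡-Reasoning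
... | no _ rewrite label-∷ {x} {m ∷ y ∷ l} x<m | label-descent {m} {y} {l} (<-asym (All.head <m)) =
  +-identityʳ (g 1)

level : ℕ → List (List ℕ)
level zero = [] ∷ []
level (suc n) = concatMap (children n) (level n)

∈-level⇔ : ∀ n {l} → l ∈ level n ⇔ IsRS213List n l
∈-level⇔ zero {[]} = mk⇔ (λ _ → isRS213List [] [] refl (λ ()) (λ _ ()) (λ ())) (λ _ → here refl)
∈-level⇔ zero {_ ∷ _} = mk⇔ (λ { (here ()) ; (there ()) }) (λ { (isRS213List _ _ () _ _ _) })
∈-level⇔ (suc n) {c} = mk⇔ child⇒RS213 RS213⇒child
  where
  child⇒RS213 : c ∈ level (suc n) → IsRS213List (suc n) c
  child⇒RS213 c∈ with Inverse.from >>=-∈↔ c∈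
  ... | l , l∈ , c∈children with Equivalence.to (∈-level⇔ n) l∈
  ... | rs@(isRS213List bounded unique _ _ simsun _)
    with ∈-children⁻ l unique (simsun⇒¬doubleDescent bounded simsun) c∈children
  ... | insertion a b refl refl inc noDescent = insertMax-isRS213List a rs inc noDescent
  RS213⇒child : IsRS213List (suc n) c → c ∈ level (suc n)
  RS213⇒child rs with ∈-∃++ (IsRS213List.complete rs (n<1+n n))
  ... | a , b , refl with deleteMax-isRS213List a rs
  ... | rs′ , inc , noDescent =
    Inverse.to >>=-∈↔ (a ++ b , Equivalence.from (∈-level⇔ n) rs′ , ∈-children⁺ a b inc noDescent)

level-unique : ∀ n → Unique (level n)
level-unique zero = [] ∷ []
level-unique (suc n) =
  Unique-concatMap (filter (_<? n)) (level-unique n)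
    (λ l∈ → children-unique _ (IsRS213List.bounded (Equivalence.to (∈-level⇔ n) l∈)))
    (λ l∈ → filter-children (Equivalence.to (∈-level⇔ n) l∈))

sum-treeCount-level : ∀ n len → sum (map (treeCount len ∘ label) (level n)) ≡ treeCount (n + len) 0
sum-treeCount-level zero len = +-identityʳ _
sum-treeCount-level (suc n) len = begin
  sum (map (treeCount len ∘ label) (concatMap (children n) (level n)))
    ≡⟨ sum-concatMap (treeCount len ∘ label) (children n) (level n) ⟩
  sum (map (sum ∘ map (treeCount len ∘ label) ∘ children n) (level n))
    ≡⟨ sum-map-cong (level n) (λ l∈ → sum-label-children _ (bounded l∈) (treeCount len)) ⟩
  sum (map (treeCount (suc len) ∘ label) (level n))
    ≡⟨ sum-treeCount-level n (suc len) ⟩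
  treeCount (n + suc len) 0
    ≡⟨ cong (λ k → treeCount k 0) (+-suc n len) ⟩
  treeCount (suc n + len) 0 ∎
  where
  open ≡-Reasoning
  bounded : ∀ {l} → l ∈ level n → All (_< n) l
  bounded = IsRS213List.bounded ∘ Equivalence.to (∈-level⇔ n)

length-level : ∀ n → length (level n) ≡ motzkin n
length-level n = begin
  length (level n)                          ≡⟨ sum-map-1 (level n) ⟨
  sum (map (treeCount 0 ∘ label) (level n)) ≡⟨ sum-treeCount-level n 0 ⟩
  treeCount (n + 0) 0                       ≡⟨ cong (λ k → treeCount k 0) (+-identityʳ n) ⟩
  treeCount n 0                             ≡⟨ treeCount≡binomialTransform n 0 ⟩
  motzkin n                                 ∎
  where open ≡-Reasoning

HasCard-transfer : ∀ {A B : Set} {P : A → Set} {Q : B → Set} {m} (f : A → B) (g : B → A) →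
                   (∀ {x} → P x → Q (f x)) → (∀ {y} → Q y → P (g y)) →
                   (∀ x → g (f x) ≡ x) → (∀ {y} → Q y → f (g y) ≡ y) →
                   HasCard Q m → HasCard P m
HasCard-transfer {P = P} f g P⇒Q Q⇒P g∘f≡id f∘g≡id (L , unique , member , length≡) =
  map g L , unique′ , (λ x → mk⇔ (listed⇒P x) (P⇒listed x)) , trans (length-map g L) length≡
  where
  unique′ : Unique (map g L)
  unique′ = Unique.map⁻ {f = f} (subst Unique (sym f∘g-on-L) unique)
    where
    f∘g-on-L : map f (map g L) ≡ L
    f∘g-on-L = trans (sym (map-∘ L))
                     (map-id-local (All.tabulate (f∘g≡id ∘ Equivalence.to (member _))))
  listed⇒P : ∀ x → x ∈ map g L → P x
  listed⇒P x x∈ with ∈-map⁻ g x∈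
  ... | y , y∈ , refl = Q⇒P (Equivalence.to (member y) y∈)
  P⇒listed : ∀ x → P x → x ∈ map g L
  P⇒listed x px = subst (_∈ map g L) (g∘f≡id x) (∈-map⁺ g (Equivalence.from (member (f x)) (P⇒Q px)))

injective⇒surjective : ∀ {n} {f : Fin n → Fin n} → (∀ {i j} → f i ≡ f j → i ≡ j) →
                       ∀ y → ∃ λ x → f x ≡ y
injective⇒surjective {suc m} {f} injective y with any? (λ x → f x ≟ᶠ y)
... | yes hit = hit
... | no miss = ⊥-elim (1+n≰n (injective⇒≤ g-injective))
  where
  y≢f : ∀ x → y ≢ f x
  y≢f x y≡fx = miss (x , sym y≡fx)
  g : Fin (suc m) → Fin m
  g x = punchOut (y≢f x)
  g-injective : ∀ {i j} → g i ≡ g j → i ≡ j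
  g-injective {i} {j} gᵢ≡gⱼ = injective (punchOut-injective (y≢f i) (y≢f j) gᵢ≡gⱼ)

-- Contains213 σ unfolds to Contains213′ (toℕ ∘ lookup σ).
Contains213′ : ∀ {k} → (Fin k → ℕ) → Set
Contains213′ {k} f =
  Σ (Fin k) λ i → Σ (Fin k) λ j → Σ (Fin k) λ l →
    (toℕ i < toℕ j) × (toℕ j < toℕ l) × (f j < f i) × (f i < f l)

precedes-tabulate⁺ : ∀ {k} (f : Fin k → ℕ) {j l} → toℕ j < toℕ l → Precedes (f j) (f l) (tabulate f)
precedes-tabulate⁺ f {Fin.zero} {Fin.suc l} _ = here (∈-tabulate⁺ {f = f ∘ Fin.suc} l)
precedes-tabulate⁺ f {Fin.suc j} {Fin.suc l} (s<s j<l) = there (precedes-tabulate⁺ (f ∘ Fin.suc) j<l)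

precedes-tabulate⁻ : ∀ {k} (f : Fin k → ℕ) {u v} → Precedes u v (tabulate f) →
                     Σ (Fin k) λ j → Σ (Fin k) λ l → toℕ j < toℕ l × f j ≡ u × f l ≡ v
precedes-tabulate⁻ {suc k} f (here v∈) with ∈-tabulate⁻ v∈
... | l , refl = Fin.zero , Fin.suc l , z<s , refl , refl
precedes-tabulate⁻ {suc k} f (there p) with precedes-tabulate⁻ (f ∘ Fin.suc) p
... | j , l , j<l , fj≡u , fl≡v = Fin.suc j , Fin.suc l , s<s j<l , fj≡u , fl≡v

has213-tabulate⁺ : ∀ {k} (f : Fin k → ℕ) → Contains213′ f → Has213 (tabulate f)
has213-tabulate⁺ f (Fin.zero , Fin.suc j , Fin.suc l , _ , s<s j<l , fj<fi , fi<fl) =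
  here (precedes-tabulate⁺ (f ∘ Fin.suc) j<l) fj<fi fi<fl
has213-tabulate⁺ f (Fin.suc i , Fin.suc j , Fin.suc l , s<s i<j , s<s j<l , fj<fi , fi<fl) =
  there (has213-tabulate⁺ (f ∘ Fin.suc) (i , j , l , i<j , j<l , fj<fi , fi<fl))

has213-tabulate⁻ : ∀ {k} (f : Fin k → ℕ) → Has213 (tabulate f) → Contains213′ f
has213-tabulate⁻ {suc k} f (here p u<x x<v) with precedes-tabulate⁻ (f ∘ Fin.suc) p
... | j , l , j<l , refl , refl = Fin.zero , Fin.suc j , Fin.suc l , z<s , s<s j<l , u<x , x<v
has213-tabulate⁻ {suc k} f (there p) with has213-tabulate⁻ (f ∘ Fin.suc) p
... | i , j , l , i<j , j<l , fj<fi , fi<fl =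
  Fin.suc i , Fin.suc j , Fin.suc l , s<s i<j , s<s j<l , fj<fi , fi<fl

-- Simsun σ unfolds to SimsunList (letters σ).
letters : ∀ {m k} → Vec (Fin m) k → List ℕ
letters σ = map toℕ (toList σ)

letters-tabulate : ∀ {m k} (σ : Vec (Fin m) k) → letters σ ≡ tabulate (toℕ ∘ lookup σ)
letters-tabulate Vec.[] = refl
letters-tabulate (x Vec.∷ σ) = cong (toℕ x ∷_) (letters-tabulate σ)

RS213⇒isRS213List : ∀ {n} (σ : Word n) → RS213 n σ → IsRS213List n (letters σ)
RS213⇒isRS213List {n} σ (perm , simsun , avoids) =
  subst (IsRS213List n) (sym (letters-tabulate σ)) (isRS213List
    (All.tabulate⁺ (λ i → toℕ<n (lookup σ i)))
    (Unique.tabulate⁺ (λ σi≡σj → perm _ _ (toℕ-injective σi≡σj)))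
    (length-tabulate (toℕ ∘ lookup σ))
    complete
    (subst SimsunList (letters-tabulate σ) simsun)
    (avoids ∘ has213-tabulate⁻ (toℕ ∘ lookup σ)))
  where
  complete : ∀ {k} → k < n → k ∈ tabulate (toℕ ∘ lookup σ)
  complete k<n with injective⇒surjective (perm _ _) (fromℕ< k<n)
  ... | j , σj≡k = subst (_∈ tabulate (toℕ ∘ lookup σ)) (trans (cong toℕ σj≡k) (toℕ-fromℕ< k<n))
                         (∈-tabulate⁺ {f = toℕ ∘ lookup σ} j)

isRS213List⇒RS213 : ∀ {n} (σ : Word n) → IsRS213List n (letters σ) → RS213 n σ
isRS213List⇒RS213 σ (isRS213List _ unique _ _ simsun avoids) =
    (λ i j σi≡σj → Unique-tabulate⁻ (subst Unique (letters-tabulate σ) unique) (cong toℕ σi≡σj))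
  , simsun
  , avoids ∘ subst Has213 (sym (letters-tabulate σ)) ∘ has213-tabulate⁺ (toℕ ∘ lookup σ)

-- The default letter d and the padding are junk values that never occur on the lists we decode.
toLetter : ∀ {m} → Fin m → ℕ → Fin m
toLetter {m} d x with x <? m
... | yes x<m = fromℕ< x<m
... | no _ = d

decodeVec : ∀ {m} → Fin m → (k : ℕ) → List ℕ → Vec (Fin m) k
decodeVec d zero _ = Vec.[]
decodeVec d (suc k) [] = d Vec.∷ decodeVec d k []
decodeVec d (suc k) (x ∷ l) = toLetter d x Vec.∷ decodeVec d k l

decode : ∀ n → List ℕ → Word n
decode zero _ = Vec.[]
decode (suc n) = decodeVec Fin.zero (suc n)

toℕ-toLetter : ∀ {m} (d : Fin m) {x} → x < m → toℕ (toLetter d x) ≡ x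
toℕ-toLetter {m} d {x} x<m with x <? m
... | yes x<m = toℕ-fromℕ< x<m
... | no x≮m = ⊥-elim (x≮m x<m)

toLetter-toℕ : ∀ {m} (d : Fin m) x → toLetter d (toℕ x) ≡ x
toLetter-toℕ {m} d x with toℕ x <? m
... | yes x<m = fromℕ<-toℕ x x<m
... | no x≮m = ⊥-elim (x≮m (toℕ<n x))

letters-decodeVec : ∀ {m} (d : Fin m) {k l} → All (_< m) l → length l ≡ k →
                    letters (decodeVec d k l) ≡ l
letters-decodeVec d {zero} {[]} [] _ = refl
letters-decodeVec d {suc k} {x ∷ l} (x<m ∷ <m) length≡ =
  cong₂ _∷_ (toℕ-toLetter d x<m) (letters-decodeVec d <m (suc-injective length≡))

decodeVec-letters : ∀ {m k} (d : Fin m) (σ : Vec (Fin m) k) → decodeVec d k (letters σ) ≡ σ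
decodeVec-letters d Vec.[] = refl
decodeVec-letters d (x Vec.∷ σ) = cong₂ Vec._∷_ (toLetter-toℕ d x) (decodeVec-letters d σ)

letters-decode : ∀ {n l} → IsRS213List n l → letters (decode n l) ≡ l
letters-decode {zero} {[]} _ = refl
letters-decode {suc n} (isRS213List bounded _ length≡ _ _ _) = letters-decodeVec Fin.zero bounded length≡

decode-letters : ∀ {n} (σ : Word n) → decode n (letters σ) ≡ σ
decode-letters {zero} Vec.[] = refl
decode-letters {suc n} σ = decodeVec-letters Fin.zero σ

RS213-hasCard : ∀ n → HasCard (RS213 n) (length (level n))
RS213-hasCard n =
  HasCard-transfer letters (decode n)
    (RS213⇒isRS213List _)
    (λ {l} rs → isRS213List⇒RS213 (decode n l) (subst (IsRS213List n) (sym (letters-decode rs)) rs))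
    decode-letters letters-decode
    (level n , level-unique n , (λ _ → ∈-level⇔ n) , refl)

theorem3p1 : ∀ (n : ℕ) → 1 ≤ n → HasCard (RS213 n) (motzkin n)
theorem3p1 n _ = subst (HasCard (RS213 n)) (length-level n) (RS213-hasCard n)
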